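{- Let $\tau$ be a finite unary vocabulary and $\mathfrak{M}$ a $\tau$-model of size $n$. Let $T = \{\pi_1,\dots,\pi_\ell\}$ be the types realized in $\mathfrak{M}$, enumerated so that $|\pi_1|\leq\dots\leq|\pi_\ell|$. Let $\mathfrak{M}'$ be the model obtained from $\mathfrak{M}$ by changing the type of one point from $\pi_{\ell-1}$ to $\pi_\ell$. If an $\mathrm{FO}[\tau]$-sentence $\varphi$ satisfies $\mathfrak{M}\models\varphi$ and $\mathfrak{M}'\not\models\varphi$, then $\varphi$ has at least $|\pi_{\ell-1}|$ quantifiers.
   Context: A $\tau$-model of size $n$ has domain $\{1,\dots,n\}$ and interprets each unary symbol of $\tau$ as a subset. A $\tau$-type is a subset $\pi\subseteq\tau$; a point realizes $\pi$ if it belongs to exactly the relations named in $\pi$; $|\pi|$ is the number of points of $\mathfrak{M}$ realizing $\pi$. Changing the type of a point from $\pi$ to $\pi'$ means modifying the unary relations at that point so that it realizes $\pi'$. $\mathrm{FO}[\tau]$ has atoms $x=y$, $P(x)$, connectives $\neg,\lor,\land$ and quantifiers $\exists,\forall$. -}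

module Defs where

open import Data.Nat using (ℕ; zero; suc; _+_; _≤_)
open import Data.Fin using (Fin; zero; suc)
open import Data.Fin.Subset using (Subset) renaming (_∈_ to _∈ₛ_)
open import Data.Bool using (Bool) renaming (_≟_ to _≟ᵇ_)
open import Data.Vec using (Vec; lookup; tabulate; _[_]≔_)
open import Data.Vec.Properties using (≡-dec)
open import Data.List using (List; length; filter)
open import Data.List.Base using (allFin)
open import Data.Product using (Σ; _×_)
open import Data.Sum using (_⊎_)
open import Relation.Nullary using (¬_)
open import Relation.Binary.PropositionalEquality using (_≡_)
open import Relation.Binary.Definitions using (DecidableEquality)

-- Vocabulary τ = {P_0, ..., P_{k-1}} (k unary symbols, indexed by Fin k).
Model : ℕ → ℕ → Set
Model k n = Fin k → Subset n

TypeT : ℕ → Set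
TypeT k = Subset k

_≟T_ : ∀ {k} → DecidableEquality (TypeT k)
_≟T_ = ≡-dec _≟ᵇ_

typeOf : ∀ {k n} → Model k n → Fin n → TypeT k
typeOf M p = tabulate (λ i → lookup (M i) p)

Realizes : ∀ {k n} → Model k n → Fin n → TypeT k → Set
Realizes M p π = typeOf M p ≡ π

count : ∀ {k n} → Model k n → TypeT k → ℕ
count {n = n} M π = length (filter (λ p → typeOf M p ≟T π) (allFin n))

Realized : ∀ {k n} → Model k n → TypeT k → Set
Realized {n = n} M π = Σ (Fin n) (λ p → Realizes M p π)

changeType : ∀ {k n} → Model k n → Fin n → TypeT k → Model k n
changeType M p π' i = M i [ p ]≔ lookup π' i

-- FO[τ] formulas with free variables among Fin m (de Bruijn style).
data Formula (k : ℕ) : ℕ → Set where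
  eq   : ∀ {m} → Fin m → Fin m → Formula k m
  rel  : ∀ {m} → Fin k → Fin m → Formula k m
  neg  : ∀ {m} → Formula k m → Formula k m
  or   : ∀ {m} → Formula k m → Formula k m → Formula k m
  and  : ∀ {m} → Formula k m → Formula k m → Formula k m
  ex   : ∀ {m} → Formula k (suc m) → Formula k m
  all  : ∀ {m} → Formula k (suc m) → Formula k m

Sentence : ℕ → Set
Sentence k = Formula k 0

quantifiers : ∀ {k m} → Formula k m → ℕ
quantifiers (eq x y)  = 0
quantifiers (rel i x) = 0
quantifiers (neg φ)   = quantifiers φ
quantifiers (or φ ψ)  = quantifiers φ + quantifiers ψ
quantifiers (and φ ψ) = quantifiers φ + quantifiers ψ
quantifiers (ex φ)    = suc (quantifiers φ)
quantifiers (all φ)   = suc (quantifiers φ)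

extend : ∀ {m n} → (Fin m → Fin n) → Fin n → Fin (suc m) → Fin n
extend a d zero    = d
extend a d (suc i) = a i

Sat : ∀ {k n m} → Model k n → Formula k m → (Fin m → Fin n) → Set
Sat M (eq x y)  a = a x ≡ a y
Sat M (rel i x) a = a x ∈ₛ M i
Sat M (neg φ)   a = ¬ Sat M φ a
Sat M (or φ ψ)  a = Sat M φ a ⊎ Sat M ψ a
Sat M (and φ ψ) a = Sat M φ a × Sat M ψ a
Sat {n = n} M (ex φ) a = Σ (Fin n) (λ d → Sat M φ (extend a d))
Sat {n = n} M (all φ) a = (d : Fin n) → Sat M φ (extend a d)

emptyAssign : ∀ {n} → Fin 0 → Fin n
emptyAssign ()

_⊨_ : ∀ {k n} → Model k n → Sentence k → Set
M ⊨ φ = Sat M φ emptyAssign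

{-# OPTIONS --safe #-}
-- An Ehrenfeucht–Fraïssé argument. Call x and y r-close (x ≈[ r ] y) if they are equal
-- or both at least r, and let r = |π₁| - 1. Changing p from π₁ to π₂ only moves
-- the counts of π₁ (down by one) and of π₂ (up by one); as |π₁| ≤ |π₂| both
-- stay at least r, so every type has r-close counts in 𝔐 and 𝔐′. Duplicator
-- survives r rounds on such models: answering a repeated point by its partner
-- and a new point by an unchosen point of the same type keeps, for every type,
-- the numbers of unchosen points close up to the number of rounds left. Hence
-- sentences with at most r quantifiers cannot tell 𝔐 and 𝔐′ apart.
module Submission where

open import Defs
open import Data.Nat using (ℕ; _≤_)
open import Data.Fin using (Fin)
open import Data.List using (List; _++_; _∷_; [])
open import Data.List.Membership.Propositional using (_∈_)
open import Data.List.Relation.Unary.Unique.Propositional using (Unique)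
open import Data.List.Relation.Unary.Linked using (Linked)
open import Function.Bundles using (_⇔_)
open import Relation.Nullary using (¬_)
open import Relation.Binary.PropositionalEquality using (_≡_)

open import Level using (0ℓ)
open import Data.Nat using (zero; suc; _+_; _<_; s≤s; z≤n)
open import Data.Nat.Properties using (≤-trans; ≤-refl; n≤1+n; n<1+n; <⇒≤; +-suc; m≤m+n; m≤n+m; ≤-pred; ≮⇒≥)
open import Data.Fin using (zero; suc; _≟_)
open import Data.Fin.Properties using (any?; all?; suc-injective)
open import Data.Fin.Subset using () renaming (_∈_ to _∈ₛ_)
open import Data.Vec using (lookup)
open import Data.Vec.Properties using (lookup∘update; lookup∘update′; lookup∘tabulate; tabulate∘lookup; tabulate-cong; []=⇒lookup; lookup⇒[]=)
open import Data.List using (length; filter; tabulate)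
import Data.List.Relation.Unary.All as All
import Data.List.Relation.Unary.AllPairs as AllPairs
open import Data.List.Relation.Unary.AllPairs using (AllPairs)
import Data.List.Relation.Unary.Linked as Linked
open import Data.Product using (_×_; _,_; proj₁; ∃)
open import Data.Product.Function.NonDependent.Propositional using (_×-⇔_)
open import Data.Sum using (_⊎_; inj₁; inj₂)
open import Data.Sum.Function.Propositional using (_⊎-⇔_)
open import Data.Empty using (⊥-elim)
open import Function using (_∘_)
open import Function.Bundles using (mk⇔; module Equivalence)
open import Function.Related.TypeIsomorphisms using (¬-cong-⇔)
import Function.Properties.Equivalence as ⇔
open import Relation.Nullary using (Dec; yes; no; ¬?)
open import Relation.Nullary.Decidable using (_×-dec_)
open import Relation.Unary using (Pred; Decidable)
open import Relation.Binary.PropositionalEquality using (_≢_; refl; sym; trans; cong; cong₂; subst; subst₂; module ≡-Reasoning)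

open Equivalence using (to; from)

private variable
  A : Set
  k m n r : ℕ

indicator : Dec A → ℕ
indicator (yes _) = 1
indicator (no _)  = 0

#_ : ∀ {n} {P : Pred (Fin n) 0ℓ} → Decidable P → ℕ
#_ {n = zero}  P? = 0
#_ {n = suc n} P? = indicator (P? zero) + # (P? ∘ suc)

indicator-cong : {B : Set} (a? : Dec A) (b? : Dec B) → A ⇔ B → indicator a? ≡ indicator b?
indicator-cong (yes _) (yes _) _    = refl
indicator-cong (yes a) (no ¬b) A⇔B = ⊥-elim (¬b (to A⇔B a))
indicator-cong (no ¬a) (yes b) A⇔B = ⊥-elim (¬a (from A⇔B b))
indicator-cong (no _)  (no _)  _    = refl

#-cong : ∀ {n} {P Q : Pred (Fin n) 0ℓ} (P? : Decidable P) (Q? : Decidable Q) → (∀ x → P x ⇔ Q x) → # P? ≡ # Q?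
#-cong {n = zero}  P? Q? P⇔Q = refl
#-cong {n = suc n} P? Q? P⇔Q =
  cong₂ _+_ (indicator-cong (P? zero) (Q? zero) (P⇔Q zero)) (#-cong (P? ∘ suc) (Q? ∘ suc) (P⇔Q ∘ suc))

#-remove : ∀ {n} {P Q : Pred (Fin n) 0ℓ} (P? : Decidable P) (Q? : Decidable Q) (i : Fin n) → P i → ¬ Q i →
           (∀ x → x ≢ i → P x ⇔ Q x) → # P? ≡ suc (# Q?)
#-remove P? Q? zero Pi ¬Qi P⇔Q with P? zero | Q? zero
... | no ¬P0 | _     = ⊥-elim (¬P0 Pi)
... | yes _  | yes Q0 = ⊥-elim (¬Qi Q0)
... | yes _  | no _  = cong suc (#-cong (P? ∘ suc) (Q? ∘ suc) (λ x → P⇔Q (suc x) λ ()))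
#-remove P? Q? (suc i) Pi ¬Qi P⇔Q = begin
  indicator (P? zero) + # (P? ∘ suc)       ≡⟨ cong₂ _+_ (indicator-cong (P? zero) (Q? zero) (P⇔Q zero λ ()))
                                                         (#-remove (P? ∘ suc) (Q? ∘ suc) i Pi ¬Qi (λ x x≢i → P⇔Q (suc x) (x≢i ∘ suc-injective))) ⟩
  indicator (Q? zero) + suc (# (Q? ∘ suc)) ≡⟨ +-suc (indicator (Q? zero)) _ ⟩
  suc (indicator (Q? zero) + # (Q? ∘ suc)) ∎
  where open ≡-Reasoning

0<#⇒∃ : ∀ {n} {P : Pred (Fin n) 0ℓ} (P? : Decidable P) → 0 < # P? → ∃ P
0<#⇒∃ {n = suc n} P? 0<# with P? zero
... | yes P0 = zero , P0
... | no _   with 0<#⇒∃ (P? ∘ suc) 0<#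
...   | x , Px = suc x , Px

∃⇒0<# : ∀ {n} {P : Pred (Fin n) 0ℓ} (P? : Decidable P) → ∃ P → 0 < # P?
∃⇒0<# P? (zero , P0) with P? zero
... | yes _  = s≤s z≤n
... | no ¬P0 = ⊥-elim (¬P0 P0)
∃⇒0<# P? (suc x , Px) with P? zero
... | yes _ = s≤s z≤n
... | no _  = ∃⇒0<# (P? ∘ suc) (x , Px)

length-filter-tabulate : {P : Pred A 0ℓ} (P? : Decidable P) (f : Fin n → A) →
                         length (filter P? (tabulate f)) ≡ # (P? ∘ f)
length-filter-tabulate {n = zero}  P? f = refl
length-filter-tabulate {n = suc n} P? f with P? (f zero)
... | yes _ = cong suc (length-filter-tabulate P? (f ∘ suc))
... | no _  = length-filter-tabulate P? (f ∘ suc)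

count≡# : (M : Model k n) (σ : TypeT k) → count M σ ≡ # (λ x → typeOf M x ≟T σ)
count≡# M σ = length-filter-tabulate (λ x → typeOf M x ≟T σ) (λ x → x)

typeOf-≡⇒∈ₛ-⇔ : (M N : Model k n) {x y : Fin n} (i : Fin k) → typeOf M x ≡ typeOf N y → (x ∈ₛ M i) ⇔ (y ∈ₛ N i)
typeOf-≡⇒∈ₛ-⇔ M N {x} {y} i x∼y = mk⇔
  (λ x∈ → lookup⇒[]= y (N i) (trans (sym same-entry) ([]=⇒lookup x∈)))
  (λ y∈ → lookup⇒[]= x (M i) (trans same-entry ([]=⇒lookup y∈)))
  where
  same-entry : lookup (M i) x ≡ lookup (N i) y
  same-entry = begin
    lookup (M i) x          ≡⟨ lookup∘tabulate (λ j → lookup (M j) x) i ⟨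
    lookup (typeOf M x) i   ≡⟨ cong (λ t → lookup t i) x∼y ⟩
    lookup (typeOf N y) i   ≡⟨ lookup∘tabulate (λ j → lookup (N j) y) i ⟩
    lookup (N i) y          ∎
    where open ≡-Reasoning

typeOf-changeType-≡ : (M : Model k n) (p : Fin n) (π : TypeT k) → typeOf (changeType M p π) p ≡ π
typeOf-changeType-≡ M p π = trans (tabulate-cong (λ i → lookup∘update p (M i) (lookup π i))) (tabulate∘lookup π)

typeOf-changeType-≢ : (M : Model k n) {p x : Fin n} (π : TypeT k) → x ≢ p →
                      typeOf (changeType M p π) x ≡ typeOf M x
typeOf-changeType-≢ M π x≢p = tabulate-cong (λ i → lookup∘update′ x≢p (M i) (lookup π i))

module _ (M : Model k n) (p : Fin n) (π′ : TypeT k) where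

  private
    M′ = changeType M p π′

    typeOf-changeType-⇔ : ∀ σ x → x ≢ p → (typeOf M′ x ≡ σ) ⇔ (typeOf M x ≡ σ)
    typeOf-changeType-⇔ σ x x≢p = mk⇔ (trans (sym (typeOf-changeType-≢ M π′ x≢p))) (trans (typeOf-changeType-≢ M π′ x≢p))

  count-changeType-old : ∀ {π} → typeOf M p ≡ π → π ≢ π′ → count M π ≡ suc (count M′ π)
  count-changeType-old {π} p∶π π≢π′ = begin
    count M π                          ≡⟨ count≡# M π ⟩
    # (λ x → typeOf M x ≟T π)          ≡⟨ #-remove _ _ p p∶π (λ p∶π → π≢π′ (trans (sym p∶π) (typeOf-changeType-≡ M p π′)))
                                                      (λ x x≢p → ⇔.sym (typeOf-changeType-⇔ π x x≢p)) ⟩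
    suc (# (λ x → typeOf M′ x ≟T π))   ≡⟨ cong suc (count≡# M′ π) ⟨
    suc (count M′ π)                   ∎
    where open ≡-Reasoning

  count-changeType-new : typeOf M p ≢ π′ → count M′ π′ ≡ suc (count M π′)
  count-changeType-new p≁π′ = begin
    count M′ π′                        ≡⟨ count≡# M′ π′ ⟩
    # (λ x → typeOf M′ x ≟T π′)        ≡⟨ #-remove _ _ p (typeOf-changeType-≡ M p π′) p≁π′ (typeOf-changeType-⇔ π′) ⟩
    suc (# (λ x → typeOf M x ≟T π′))   ≡⟨ cong suc (count≡# M π′) ⟨
    suc (count M π′)                   ∎
    where open ≡-Reasoning

  count-changeType-other : ∀ {σ} → typeOf M p ≢ σ → π′ ≢ σ → count M′ σ ≡ count M σ
  count-changeType-other {σ} p≁σ π′≢σ = begin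
    count M′ σ                         ≡⟨ count≡# M′ σ ⟩
    # (λ x → typeOf M′ x ≟T σ)         ≡⟨ #-cong _ _ same-type ⟩
    # (λ x → typeOf M x ≟T σ)          ≡⟨ count≡# M σ ⟨
    count M σ                          ∎
    where
    open ≡-Reasoning
    same-type : ∀ x → (typeOf M′ x ≡ σ) ⇔ (typeOf M x ≡ σ)
    same-type x with x ≟ p
    ... | yes refl = mk⇔ (⊥-elim ∘ π′≢σ ∘ trans (sym (typeOf-changeType-≡ M p π′))) (⊥-elim ∘ p≁σ)
    ... | no x≢p   = typeOf-changeType-⇔ σ x x≢p

_≈[_]_ : ℕ → ℕ → ℕ → Set
x ≈[ r ] y = x ≡ y ⊎ (r ≤ x × r ≤ y)

≈-sym : ∀ {x y} → x ≈[ r ] y → y ≈[ r ] x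
≈-sym (inj₁ x≡y)         = inj₁ (sym x≡y)
≈-sym (inj₂ (r≤x , r≤y)) = inj₂ (r≤y , r≤x)

≈-weaken : ∀ {x y} → x ≈[ suc r ] y → x ≈[ r ] y
≈-weaken (inj₁ x≡y)         = inj₁ x≡y
≈-weaken (inj₂ (r<x , r<y)) = inj₂ (≤-trans (n≤1+n _) r<x , ≤-trans (n≤1+n _) r<y)

≈-pred : ∀ {x y} → suc x ≈[ suc r ] suc y → x ≈[ r ] y
≈-pred (inj₁ refl)                  = inj₁ refl
≈-pred (inj₂ (s≤s r≤x , s≤s r≤y)) = inj₂ (r≤x , r≤y)

≈-pos : ∀ {x y} → x ≈[ suc r ] y → 0 < x → 0 < y
≈-pos (inj₁ refl)     0<x = 0<x
≈-pos (inj₂ (_ , r<y)) _  = ≤-trans (s≤s z≤n) r<y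

Unused : Model k n → (Fin m → Fin n) → TypeT k → Pred (Fin n) 0ℓ
Unused M a σ x = typeOf M x ≡ σ × (∀ i → a i ≢ x)

unused? : (M : Model k n) (a : Fin m → Fin n) (σ : TypeT k) → Decidable (Unused M a σ)
unused? M a σ x = (typeOf M x ≟T σ) ×-dec all? (λ i → ¬? (a i ≟ x))

#unused : Model k n → (Fin m → Fin n) → TypeT k → ℕ
#unused M a σ = # (unused? M a σ)

#unused-emptyAssign : (M : Model k n) (σ : TypeT k) → #unused M emptyAssign σ ≡ count M σ
#unused-emptyAssign M σ = begin
  #unused M emptyAssign σ      ≡⟨ #-cong (unused? M emptyAssign σ) (λ x → typeOf M x ≟T σ) (λ x → mk⇔ proj₁ (_, λ ())) ⟩
  # (λ x → typeOf M x ≟T σ)    ≡⟨ count≡# M σ ⟨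
  count M σ                    ∎
  where open ≡-Reasoning

module _ (M : Model k n) (a : Fin m → Fin n) where

  #unused-extend-used : ∀ {d} i → a i ≡ d → (σ : TypeT k) → #unused M (extend a d) σ ≡ #unused M a σ
  #unused-extend-used i aᵢ≡d σ = #-cong (unused? M (extend a _) σ) (unused? M a σ) λ x → mk⇔
    (λ (x∶σ , fresh) → x∶σ , fresh ∘ suc)
    (λ (x∶σ , fresh) → x∶σ , λ { zero d≡x → fresh i (trans aᵢ≡d d≡x) ; (suc j) → fresh j })

  #unused-extend-unused : ∀ {d σ} → Unused M a σ d → #unused M a σ ≡ suc (#unused M (extend a d) σ)
  #unused-extend-unused {d} {σ} d-unused =
    #-remove (unused? M a σ) (unused? M (extend a d) σ) d d-unused (λ (_ , fresh) → fresh zero refl) λ x x≢d → mk⇔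
    (λ (x∶σ , fresh) → x∶σ , λ { zero d≡x → x≢d (sym d≡x) ; (suc j) → fresh j })
    (λ (x∶σ , fresh) → x∶σ , fresh ∘ suc)

  #unused-extend-otherType : ∀ {d σ} → typeOf M d ≢ σ → #unused M (extend a d) σ ≡ #unused M a σ
  #unused-extend-otherType {d} {σ} d≁σ = #-cong (unused? M (extend a d) σ) (unused? M a σ) λ x → mk⇔
    (λ (x∶σ , fresh) → x∶σ , fresh ∘ suc)
    (λ (x∶σ , fresh) → x∶σ , λ { zero d≡x → d≁σ (trans (cong (typeOf M) d≡x) x∶σ) ; (suc j) → fresh j })

-- Duplicator's invariant in the Ehrenfeucht–Fraïssé game with r rounds left,
-- at the position where the points a and b have been chosen in M and N.
record Winning (r : ℕ) (M N : Model k n) (a b : Fin m → Fin n) : Set where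
  field
    ≡-to     : ∀ i j → a i ≡ a j → b i ≡ b j
    ≡-from   : ∀ i j → b i ≡ b j → a i ≡ a j
    typeOf-≡ : ∀ i → typeOf M (a i) ≡ typeOf N (b i)
    unused-≈ : ∀ σ → #unused M a σ ≈[ r ] #unused N b σ

open Winning

Winning-sym : ∀ {M N : Model k n} {a b : Fin m → Fin n} → Winning r M N a b → Winning r N M b a
Winning-sym W = record
  { ≡-to     = ≡-from W
  ; ≡-from   = ≡-to W
  ; typeOf-≡ = sym ∘ typeOf-≡ W
  ; unused-≈ = ≈-sym ∘ unused-≈ W
  }

Winning-emptyAssign : {M N : Model k n} → (∀ σ → count M σ ≈[ r ] count N σ) →
                      Winning r M N emptyAssign emptyAssign
Winning-emptyAssign {M = M} {N} counts-≈ = record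
  { ≡-to     = λ ()
  ; ≡-from   = λ ()
  ; typeOf-≡ = λ ()
  ; unused-≈ = λ σ → subst₂ _≈[ _ ]_ (sym (#unused-emptyAssign M σ))
                                     (sym (#unused-emptyAssign N σ)) (counts-≈ σ)
  }

extend-preserves-≡ : {a b : Fin m → Fin n} {d e : Fin n} →
                     (∀ i j → a i ≡ a j → b i ≡ b j) → (∀ j → d ≡ a j → e ≡ b j) →
                     ∀ i j → extend a d i ≡ extend a d j → extend b e i ≡ extend b e j
extend-preserves-≡ a-to-b d-to-e zero    zero    _    = refl
extend-preserves-≡ a-to-b d-to-e zero    (suc j) same = d-to-e j same
extend-preserves-≡ a-to-b d-to-e (suc i) zero    same = sym (d-to-e i (sym same))
extend-preserves-≡ a-to-b d-to-e (suc i) (suc j) same = a-to-b i j same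

module _ {M N : Model k n} {a b : Fin m → Fin n} (W : Winning (suc r) M N a b) where

  extend-Winning : ∀ {d e} → (∀ j → d ≡ a j → e ≡ b j) → (∀ j → e ≡ b j → d ≡ a j) →
                   typeOf M d ≡ typeOf N e →
                   (∀ σ → #unused M (extend a d) σ ≈[ r ] #unused N (extend b e) σ) →
                   Winning r M N (extend a d) (extend b e)
  extend-Winning d-to-e e-to-d d∼e unused-≈′ = record
    { ≡-to     = extend-preserves-≡ (≡-to W) d-to-e
    ; ≡-from   = extend-preserves-≡ (≡-from W) e-to-d
    ; typeOf-≡ = λ { zero → d∼e ; (suc j) → typeOf-≡ W j }
    ; unused-≈ = unused-≈′
    }

  forth-used : ∀ {d} i → a i ≡ d → Winning r M N (extend a d) (extend b (b i))
  forth-used i aᵢ≡d = extend-Winning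
    (λ j d≡aⱼ → ≡-to W i j (trans aᵢ≡d d≡aⱼ))
    (λ j bᵢ≡bⱼ → trans (sym aᵢ≡d) (≡-from W i j bᵢ≡bⱼ))
    (trans (cong (typeOf M) (sym aᵢ≡d)) (typeOf-≡ W i))
    (λ σ → subst₂ _≈[ r ]_ (sym (#unused-extend-used M a i aᵢ≡d σ))
                           (sym (#unused-extend-used N b i refl σ)) (≈-weaken (unused-≈ W σ)))

  forth-fresh : ∀ {d} → (∀ i → a i ≢ d) → ∃ λ e → Winning r M N (extend a d) (extend b e)
  forth-fresh {d} fresh with 0<#⇒∃ (unused? N b (typeOf M d))
                               (≈-pos (unused-≈ W _) (∃⇒0<# (unused? M a _) (d , refl , fresh)))
  ... | e , e∶σ , e-fresh = e , extend-Winning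
    (λ j d≡aⱼ → ⊥-elim (fresh j (sym d≡aⱼ)))
    (λ j e≡bⱼ → ⊥-elim (e-fresh j (sym e≡bⱼ)))
    (sym e∶σ)
    unused-≈′
    where
    σ = typeOf M d
    unused-≈′ : ∀ τ → #unused M (extend a d) τ ≈[ r ] #unused N (extend b e) τ
    unused-≈′ τ with σ ≟T τ
    ... | yes refl = ≈-pred (subst₂ _≈[ suc r ]_ (#unused-extend-unused M a (refl , fresh))
                                                 (#unused-extend-unused N b (e∶σ , e-fresh)) (unused-≈ W σ))
    ... | no σ≢τ   = subst₂ _≈[ r ]_ (sym (#unused-extend-otherType M a σ≢τ))
                                     (sym (#unused-extend-otherType N b (σ≢τ ∘ trans (sym e∶σ))))
                                     (≈-weaken (unused-≈ W τ))

  forth : ∀ d → ∃ λ e → Winning r M N (extend a d) (extend b e)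
  forth d with any? (λ i → a i ≟ d)
  ... | yes (i , aᵢ≡d) = b i , forth-used i aᵢ≡d
  ... | no  d-fresh    = forth-fresh (λ i aᵢ≡d → d-fresh (i , aᵢ≡d))

back : ∀ {M N : Model k n} {a b : Fin m → Fin n} → Winning (suc r) M N a b →
       ∀ e → ∃ λ d → Winning r M N (extend a d) (extend b e)
back W e with forth (Winning-sym W) e
... | d , W′ = d , Winning-sym W′

Winning⇒Sat-⇔ : ∀ {M N : Model k n} {a b : Fin m → Fin n} (φ : Formula k m) →
                quantifiers φ ≤ r → Winning r M N a b → Sat M φ a ⇔ Sat N φ b
Winning⇒Sat-⇔ (eq x y)  _ W = mk⇔ (≡-to W x y) (≡-from W x y)
Winning⇒Sat-⇔ {M = M} {N} (rel i x) _ W = typeOf-≡⇒∈ₛ-⇔ M N i (typeOf-≡ W x)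
Winning⇒Sat-⇔ (neg φ)   q W = ¬-cong-⇔ (Winning⇒Sat-⇔ φ q W)
Winning⇒Sat-⇔ (or φ ψ)  q W = Winning⇒Sat-⇔ φ (≤-trans (m≤m+n _ _) q) W ⊎-⇔ Winning⇒Sat-⇔ ψ (≤-trans (m≤n+m _ _) q) W
Winning⇒Sat-⇔ (and φ ψ) q W = Winning⇒Sat-⇔ φ (≤-trans (m≤m+n _ _) q) W ×-⇔ Winning⇒Sat-⇔ ψ (≤-trans (m≤n+m _ _) q) W
Winning⇒Sat-⇔ (ex φ)  (s≤s q) W = mk⇔
  (λ (d , s) → let e , W′ = forth W d in e , to (Winning⇒Sat-⇔ φ q W′) s)
  (λ (e , s) → let d , W′ = back W e in d , from (Winning⇒Sat-⇔ φ q W′) s)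
Winning⇒Sat-⇔ (all φ) (s≤s q) W = mk⇔
  (λ s e → let d , W′ = back W e in to (Winning⇒Sat-⇔ φ q W′) (s d))
  (λ s d → let e , W′ = forth W d in from (Winning⇒Sat-⇔ φ q W′) (s e))

changeType-counts-≈ : (M : Model k n) (p : Fin n) {π π′ : TypeT k} →
                      typeOf M p ≡ π → π ≢ π′ → count M π ≤ count M π′ →
                      ∀ σ → count M σ ≈[ count (changeType M p π′) π ] count (changeType M p π′) σ
changeType-counts-≈ M p {π} {π′} p∶π π≢π′ |π|≤|π′| = counts-≈
  where
  M′ = changeType M p π′
  s = count M′ π
  s<|π| : s < count M π
  s<|π| = subst (s <_) (sym (count-changeType-old M p π′ p∶π π≢π′)) (n<1+n s)
  s≤|π′| : s ≤ count M π′
  s≤|π′| = ≤-trans (<⇒≤ s<|π|) |π|≤|π′|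
  counts-≈ : ∀ σ → count M σ ≈[ s ] count M′ σ
  counts-≈ σ with π ≟T σ | π′ ≟T σ
  ... | yes refl | _        = inj₂ (<⇒≤ s<|π| , ≤-refl)
  ... | no _     | yes refl = inj₂ (s≤|π′| , subst (s ≤_) (sym (count-changeType-new M p π′ (π≢π′ ∘ trans (sym p∶π))))
                                                      (≤-trans s≤|π′| (n≤1+n _)))
  ... | no π≢σ   | no π′≢σ  = inj₁ (sym (count-changeType-other M p π′ (π≢σ ∘ trans (sym p∶π)) π′≢σ))

Linked-++⁻ʳ : ∀ {R : A → A → Set} xs {ys} → Linked R (xs ++ ys) → Linked R ys
Linked-++⁻ʳ []       linked = linked
Linked-++⁻ʳ (_ ∷ xs) linked = Linked-++⁻ʳ xs (Linked.tail linked)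

AllPairs-++⁻ʳ : ∀ {R : A → A → Set} xs {ys} → AllPairs R (xs ++ ys) → AllPairs R ys
AllPairs-++⁻ʳ []       pairs = pairs
AllPairs-++⁻ʳ (_ ∷ xs) pairs = AllPairs-++⁻ʳ xs (AllPairs.tail pairs)

lemma1 : (k n : ℕ) (M : Model k n)
    (T : List (TypeT k)) (pre : List (TypeT k)) (π₁ π₂ : TypeT k) →
    Unique T →
    ((π : TypeT k) → (π ∈ T) ⇔ Realized M π) →
    Linked (λ σ ρ → count M σ ≤ count M ρ) T →
    T ≡ pre ++ (π₁ ∷ π₂ ∷ []) →
    (p : Fin n) → Realizes M p π₁ →
    (φ : Sentence k) → M ⊨ φ → ¬ (changeType M p π₂ ⊨ φ) →
    count M π₁ ≤ quantifiers φ
lemma1 k n M T pre π₁ π₂ unique _ sorted refl p p∶π₁ φ M⊨φ M′⊭φ =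
  ≮⇒≥ λ φ<|π₁| → M′⊭φ (to (Winning⇒Sat-⇔ φ (few-quantifiers φ<|π₁|) (Winning-emptyAssign counts-≈)) M⊨φ)
  where
  π₁≢π₂ : π₁ ≢ π₂
  π₁≢π₂ = All.head (AllPairs.head (AllPairs-++⁻ʳ pre unique))
  counts-≈ : ∀ σ → count M σ ≈[ count (changeType M p π₂) π₁ ] count (changeType M p π₂) σ
  counts-≈ = changeType-counts-≈ M p p∶π₁ π₁≢π₂ (Linked.head (Linked-++⁻ʳ pre sorted))
  few-quantifiers : quantifiers φ < count M π₁ → quantifiers φ ≤ count (changeType M p π₂) π₁
  few-quantifiers φ<|π₁| = ≤-pred (subst (quantifiers φ <_) (count-changeType-old M p π₂ p∶π₁ π₁≢π₂) φ<|π₁|)
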